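{- Let $(A,L)$ be a live automaton and let $(P,\prec)$ be a complemented-pairs lattice over $\widehat L$, with bottom element $\bot$ and top element $\top$. Then $\langle\bot.\mathsf{R},\top.\mathsf{G}\rangle\in\widehat L$.
   Context: An automaton $A$ has states $\mathit{states}(A)$, start states, actions and transitions; $\mathit{execs}^\omega(A)$ is its set of infinite executions. A complemented pair over $A$ is $p=\langle p.\mathsf{R},p.\mathsf{G}\rangle$ with $p.\mathsf{R},p.\mathsf{G}\subseteq\mathit{states}(A)$; an infinite execution $\alpha$ satisfies $p$ ($\alpha\models p$) iff, if infinitely many positions of $\alpha$ carry states in $p.\mathsf{R}$, then infinitely many carry states in $p.\mathsf{G}$. A live automaton is $(A,L)$ with $L$ a set (any cardinality) of complemented pairs such that every finite execution has a proper infinite extension execution satisfying all pairs of $L$. $\mathit{lexecs}(A,L)=\{\alpha\in\mathit{execs}^\omega(A)\mid\forall p\in L:\alpha\models p\}$; the semantic closure $\widehat L$ is the set of all complemented pairs over $A$ satisfied by every element of $\mathit{lexecs}(A,L)$. A complemented-pairs lattice over $\widehat L$ is a pair $(P,\prec)$ where $P$ is a finite subset of $\widehat L$, $\prec$ is an irreflexive partial order on $P$ (with $\preceq$ meaning $\prec$ or $=$), $P$ contains an element $\top$ with $r\preceq\top$ for all $r\in P$ and an element $\bot$ with $\bot\preceq r$ for all $r\in P$, and for every $r\in P\setminus\{\top\}$, $r.\mathsf{G}\subseteq\bigcup_{w\in\mathit{succ}(r)}w.\mathsf{R}$, where $\mathit{succ}(r)=\{w\in P\mid r\prec w\text{ and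 there is no }w'\text{ with }r\prec w'\prec w\}$. -}

module Defs where

open import Data.Nat using (ℕ; zero; suc; _≤_)
open import Data.Fin using (Fin; zero; suc; inject₁; toℕ)
open import Data.Product using (Σ; ∃; ∃-syntax; _×_; _,_)
open import Data.Sum using (_⊎_)
open import Relation.Nullary using (¬_)
open import Relation.Binary.PropositionalEquality using (_≡_)
open import Relation.Binary.Definitions using ()
open import Relation.Binary.Structures using (IsStrictPartialOrder)

record Automaton : Set₁ where
  field
    State  : Set
    Action : Set
    start  : State → Set
    trans  : State → Action → State → Set
open Automaton public

module _ (A : Automaton) where

  record InfExec : Set where
    field
      st   : ℕ → State A
      act  : ℕ → Action A
      init : start A (st 0)
      step : ∀ i → trans A (st i) (act i) (st (suc i))
  open InfExec public

  record FinExec : Set where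
    field
      len   : ℕ
      fst   : Fin (suc len) → State A
      fact  : Fin len → Action A
      finit : start A (fst zero)
      fstep : ∀ (i : Fin len) → trans A (fst (inject₁ i)) (fact i) (fst (suc i))
  open FinExec public

  -- The infinite execution α extends the finite execution e (it is
  -- automatically a proper extension, being infinite).
  Extends : InfExec → FinExec → Set
  Extends α e = (∀ (i : Fin (suc (len e))) → st α (toℕ i) ≡ fst e i)
              × (∀ (i : Fin (len e)) → act α (toℕ i) ≡ fact e i)

  record CPair : Set₁ where
    constructor ⟨_,_⟩
    field
      R : State A → Set
      G : State A → Set
  open CPair public

InfOften : (ℕ → Set) → Set
InfOften P = ¬ (∃[ n ] (∀ m → n ≤ m → ¬ P m))

module _ {A : Automaton} where

  _⊨_ : InfExec A → CPair A → Set
  α ⊨ p = InfOften (λ i → R p (st α i)) → InfOften (λ i → G p (st α i))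

  LExec : (CPair A → Set) → InfExec A → Set₁
  LExec L α = ∀ p → L p → α ⊨ p

  Closure : (CPair A → Set) → CPair A → Set₁
  Closure L p = ∀ (α : InfExec A) → LExec L α → α ⊨ p

IsLive : (A : Automaton) → (CPair A → Set) → Set₁
IsLive A L = ∀ (e : FinExec A) → Σ (InfExec A) (λ α → Extends A α e × LExec L α)

-- A complemented-pairs lattice over L̂. The finite set P is given as a
-- family indexed by Fin k; the order ≺ is on the indices.
record CPLattice (A : Automaton) (L : CPair A → Set) : Set₂ where
  field
    k       : ℕ
    elem    : Fin k → CPair A
    inClos  : ∀ r → Closure L (elem r)
    _≺_     : Fin k → Fin k → Set
    isSPO   : IsStrictPartialOrder _≡_ _≺_
    top     : Fin k
    bot     : Fin k
    top-max : ∀ r → r ≺ top ⊎ r ≡ top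
    bot-min : ∀ r → bot ≺ r ⊎ bot ≡ r
  Succ : Fin k → Fin k → Set
  Succ r w = r ≺ w × ¬ (∃[ w' ] (r ≺ w' × w' ≺ w))
  field
    cover : ∀ r → ¬ (r ≡ top) → ∀ (s : State A) → G (elem r) s →
            ∃[ w ] (Succ r w × R (elem w) s)

{-# OPTIONS --safe #-}
module Submission where

open import Defs
open import Data.Nat using (ℕ; zero; suc; _≤_; _⊔_)
open import Data.Nat.Properties using (m≤m⊔n; m≤n⊔m; ≤-trans)
open import Data.Fin using (Fin; zero; suc; _≟_)
open import Data.Fin.Induction using (spo-noetherian)
open import Data.Product using (∃-syntax; _×_; _,_)
open import Effect.Monad using (RawMonad)
open import Function using (const)
open import Level using (0ℓ)
open import Induction.WellFounded using (Acc; acc)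
open import Relation.Nullary using (¬_; yes; no; contradiction; contraposition)
open import Relation.Nullary.Decidable using (¬¬-excluded-middle)
open import Relation.Nullary.Negation using (¬¬-Monad)
open import Relation.Binary.PropositionalEquality using (_≡_; refl)

-- Suppose G(⊤) occurs only finitely often along α ∈ lexecs(A, L).  By downward
-- induction over the finite order, R(r) then occurs only finitely often for
-- every r ∈ P: for r = ⊤ this is ⟨⊤.R, ⊤.G⟩ ∈ L̂; otherwise each state in G(r)
-- lies in R(w) for a successor w, the finitely many w ≻ r have R(w) rare by
-- induction, so G(r) is rare and hence so is R(r), as r ∈ L̂.  At r = ⊥ this
-- is the claim.  Everything holds in the double-negation monad, which is where
-- the classical reading of "finitely often" in InfOften lives.

open RawMonad (¬¬-Monad {a = 0ℓ}) using (pure; _>>=_; _<$>_; zipWith)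

-- InfOften P is by definition ¬ Eventually (λ m → ¬ P m).
Eventually : (ℕ → Set) → Set
Eventually P = ∃[ n ] (∀ m → n ≤ m → P m)

module _ {P Q : ℕ → Set} where

  eventually-map : (∀ {m} → P m → Q m) → Eventually P → Eventually Q
  eventually-map f (n , p) = n , λ m n≤m → f (p m n≤m)

  eventually-× : Eventually P → Eventually Q → Eventually (λ m → P m × Q m)
  eventually-× (n₁ , p) (n₂ , q) =
    n₁ ⊔ n₂ , λ m n₁⊔n₂≤m →
      p m (≤-trans (m≤m⊔n n₁ n₂) n₁⊔n₂≤m) , q m (≤-trans (m≤n⊔m n₁ n₂) n₁⊔n₂≤m)

¬¬-eventually-under : {C : Set} {P : ℕ → Set} →
  (C → ¬ ¬ Eventually P) → ¬ ¬ Eventually (λ m → C → P m)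
¬¬-eventually-under h = ¬¬-excluded-middle >>= λ where
  (yes c) → eventually-map const <$> h c
  (no ¬c) → pure (0 , λ _ _ c → contradiction c ¬c)

¬¬-eventually-∀Fin : ∀ {k} {Q : Fin k → ℕ → Set} →
  (∀ w → ¬ ¬ Eventually (Q w)) → ¬ ¬ Eventually (λ m → ∀ w → Q w m)
¬¬-eventually-∀Fin {zero} _ = pure (0 , λ _ _ ())
¬¬-eventually-∀Fin {suc k} {Q} h =
  zipWith (λ e₀ eₛ → eventually-map cons (eventually-× e₀ eₛ))
          (h zero) (¬¬-eventually-∀Fin (λ w → h (suc w)))
  where
  cons : ∀ {m} → Q zero m × (∀ w → Q (suc w) m) → ∀ w → Q w m
  cons (q₀ , _)  zero    = q₀
  cons (_  , qₛ) (suc w) = qₛ w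

module _ {A : Automaton} {L : CPair A → Set} (P : CPLattice A L)
         (α : InfExec A) (α-live : LExec L α) where
  open CPLattice P

  RareR RareG : Fin k → Set
  RareR r = ¬ InfOften (λ i → R (elem r) (st α i))
  RareG r = ¬ InfOften (λ i → G (elem r) (st α i))

  rareG-if-successors-rareR : ∀ r → ¬ r ≡ top → (∀ w → r ≺ w → RareR w) → RareG r
  rareG-if-successors-rareR r r≢top rare-succ =
    eventually-map not-G <$> ¬¬-eventually-∀Fin (λ w → ¬¬-eventually-under (rare-succ w))
    where
    not-G : ∀ {m} → (∀ w → r ≺ w → ¬ R (elem w) (st α m)) → ¬ G (elem r) (st α m)
    not-G no-R g with cover r r≢top _ g
    ... | w , (r≺w , _) , Rw = no-R w r≺w Rw

  rareR-all : RareG top → ∀ r → RareR r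
  rareR-all rareG-top r = go r (spo-noetherian isSPO r)
    where
    go : ∀ r → Acc (λ x y → y ≺ x) r → RareR r
    go r (acc rec) with r ≟ top
    ... | yes refl  = contraposition (inClos top α α-live) rareG-top
    ... | no r≢top  = contraposition (inClos r α α-live)
      (rareG-if-successors-rareR r r≢top (λ w r≺w → go w (rec r≺w)))

lemma11 : (A : Automaton) (L : CPair A → Set) → IsLive A L →
    (P : CPLattice A L) →
    Closure L ⟨ R (CPLattice.elem P (CPLattice.bot P)) , G (CPLattice.elem P (CPLattice.top P)) ⟩
lemma11 A L _ P α α-live infR-bot G-top-eventually-absent =
  rareR-all P α α-live (λ infG-top → infG-top G-top-eventually-absent) (CPLattice.bot P) infR-bot
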